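{- There are infinitely many $n$ such that every deterministic OBDD on $n$ variables computing $\mathtt{NotO_n}$ has width at least $n/2+1$.
   Context: For $\nu\in\{0,1\}^n$ let $\#_0(\nu)$, $\#_1(\nu)$ be the numbers of zeros and ones in $\nu$. $\mathtt{NotO_n}(\nu)=0$ if $\#_0(\nu)=\#_1(\nu)$ and $1$ otherwise. A deterministic OBDD on variables $x_1,\dots,x_n$ with order $\pi$ (a permutation of $\{1,\dots,n\}$) is a leveled directed acyclic graph with levels $0,\dots,n$, a single source node at level $0$, where every node at level $j-1$ has exactly one outgoing edge labelled $0$ and one labelled $1$ to nodes at level $j$, and the nodes at level $n$ are accepting or rejecting; on input $\nu$ one starts at the source and at step $j$ follows the edge labelled $\nu_{\pi(j)}$, accepting iff the final node is accepting. The width is the maximum number of nodes in a level. -}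

module Defs where

open import Data.Nat using (ℕ; zero; suc; _+_; _⊔_)
open import Data.Bool using (Bool; true; false; if_then_else_)
open import Data.Fin using (Fin; zero; suc; inject₁; fromℕ; toℕ)
open import Data.Vec.Functional using (Vector)
open import Data.Nat using (_≟_; _<_; s≤s; z≤n)
open import Data.Nat.Properties using (m<n⇒m<1+n)
open import Data.Fin using (fromℕ<)
open import Data.Fin.Properties using (toℕ-injective; toℕ-fromℕ<; toℕ-inject₁; fromℕ<-toℕ; toℕ<n)
open import Relation.Nullary.Decidable using (does)
open import Relation.Binary.PropositionalEquality using (_≡_; refl; subst; trans; sym)
open import Data.Fin.Permutation using (Permutation; _⟨$⟩ʳ_)

Input : ℕ → Set
Input n = Fin n → Bool

#₁ : ∀ {n} → Input n → ℕ
#₁ {zero}  ν = 0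
#₁ {suc n} ν = (if ν zero then 1 else 0) + #₁ (λ i → ν (suc i))

#₀ : ∀ {n} → Input n → ℕ
#₀ {zero}  ν = 0
#₀ {suc n} ν = (if ν zero then 0 else 1) + #₀ (λ i → ν (suc i))

NotO : ∀ n → Input n → Bool
NotO n ν = if does (#₀ ν ≟ #₁ ν) then false else true

record OBDD (n : ℕ) (π : Permutation n n) : Set where
  field
    size    : Fin (suc n) → ℕ
    source  : size zero ≡ 1
    -- edge from node at level j-1 = inject₁ j to level j = suc j labelled by a bit
    next    : (j : Fin n) → Fin (size (inject₁ j)) → Bool → Fin (size (suc j))
    accept  : Fin (size (fromℕ n)) → Bool

src : ∀ {n π} (B : OBDD n π) → Fin (OBDD.size B zero)
src B rewrite OBDD.source B = zero

reachAux : ∀ {n π} (B : OBDD n π) → Input n → (k : ℕ) → (lt : k < suc n) →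
           Fin (OBDD.size B (fromℕ< lt))
reachAux B ν zero (s≤s z≤n) = src B
reachAux {n} {π} B ν (suc k) (s≤s k<n) =
  subst (λ i → Fin (OBDD.size B i)) (eq k<n)
    (OBDD.next B (fromℕ< k<n)
      (subst (λ i → Fin (OBDD.size B i)) (eq′ k<n) (reachAux B ν k (m<n⇒m<1+n k<n)))
      (ν (π ⟨$⟩ʳ fromℕ< k<n)))
  where
  eq : ∀ {k} (k<n : k < n) → suc (fromℕ< k<n) ≡ fromℕ< (s≤s k<n)
  eq k<n = refl
  eq′ : ∀ {k} (k<n : k < n) → fromℕ< (m<n⇒m<1+n k<n) ≡ inject₁ (fromℕ< k<n)
  eq′ k<n = toℕ-injective (trans (toℕ-fromℕ< _) (sym (trans (toℕ-inject₁ _) (toℕ-fromℕ< k<n))))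

reach : ∀ {n π} (B : OBDD n π) → Input n → (k : Fin (suc n)) → Fin (OBDD.size B k)
reach B ν k = subst (λ i → Fin (OBDD.size B i)) (fromℕ<-toℕ k (toℕ<n k)) (reachAux B ν (toℕ k) (toℕ<n k))

evalOBDD : ∀ {n π} (B : OBDD n π) → Input n → Bool
evalOBDD B ν = OBDD.accept B (reach B ν (fromℕ _))

Computes : ∀ {n π} → OBDD n π → (Input n → Bool) → Set
Computes {n} B f = (ν : Input n) → evalOBDD B ν ≡ f ν

maxF : ∀ {m} → (Fin m → ℕ) → ℕ
maxF {zero}  f = 0
maxF {suc m} f = f zero ⊔ maxF (λ i → f (suc i))

width : ∀ {n π} → OBDD n π → ℕ
width B = maxF (OBDD.size B)

-- Let n = 2m and read the inputs in the order π of a given OBDD. After m steps, the words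
-- 1^a 0^(m-a) (a = 0, …, m) must sit at pairwise distinct nodes: if a < b reached the same
-- node, then appending 1^(m-a) 0^a to either prefix leads to the same accepting or rejecting
-- node, yet the completion of a is balanced and that of b is not. So level m has at least
-- m + 1 nodes, i.e. 2 · width ≥ n + 2.
module Submission where

open import Defs
open import Data.Nat using (ℕ; _+_; _*_; _≤_)
open import Data.Product using (Σ; _×_)
open import Data.Fin.Permutation using (Permutation)

open import Data.Nat using (zero; suc; _<_; _∸_; _<ᵇ_; s≤s; z≤n; s≤s⁻¹; _≤?_)
open import Data.Nat.Properties
open import Data.Nat.Tactic.RingSolver using (solve-∀)
open import Data.Bool using (Bool; true; false; if_then_else_)
open import Data.Fin as Fin using (Fin; toℕ; fromℕ; fromℕ<; splitAt)
open import Data.Fin.Properties using (toℕ-fromℕ; toℕ-fromℕ<; fromℕ<-toℕ; toℕ<n; pigeonhole)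
open import Data.Fin.Permutation using (_⟨$⟩ʳ_; _⟨$⟩ˡ_; inverseˡ)
open import Data.Vec.Functional using (_++_)
open import Data.Vec.Functional.Properties using (lookup-++-<; lookup-++-≥)
open import Data.Product using (_,_)
open import Data.Sum using (inj₁; inj₂)
open import Relation.Binary.PropositionalEquality
open import Relation.Nullary using (yes; no; contradiction)
open import Relation.Nullary.Decidable using (dec-true; dec-false)
open import Algebra.Properties.CommutativeMonoid.Sum +-0-commutativeMonoid
  using (sum; sum-permute; sum-cong-≗)

bit : Bool → ℕ
bit b = if b then 1 else 0

#₁≡sum : ∀ {n} (ν : Input n) → #₁ ν ≡ sum (λ i → bit (ν i))
#₁≡sum {zero}  ν = refl
#₁≡sum {suc n} ν = cong (bit (ν Fin.zero) +_) (#₁≡sum (λ i → ν (Fin.suc i)))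

#₁-cong : ∀ {n} {ν μ : Input n} → (∀ i → ν i ≡ μ i) → #₁ ν ≡ #₁ μ
#₁-cong {zero}  ν≗μ = refl
#₁-cong {suc n} ν≗μ = cong₂ (λ b r → bit b + r) (ν≗μ Fin.zero) (#₁-cong (λ i → ν≗μ (Fin.suc i)))

#₀+#₁≡n : ∀ {n} (ν : Input n) → #₀ ν + #₁ ν ≡ n
#₀+#₁≡n {zero}  ν = refl
#₀+#₁≡n {suc n} ν with ν Fin.zero
... | true  = trans (+-suc _ _) (cong suc (#₀+#₁≡n (λ i → ν (Fin.suc i))))
... | false = cong suc (#₀+#₁≡n (λ i → ν (Fin.suc i)))

++-suc : ∀ {m n} (u : Input (suc m)) (v : Input n) (i : Fin (m + n)) →
         (u ++ v) (Fin.suc i) ≡ ((λ x → u (Fin.suc x)) ++ v) i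
++-suc {m} u v i with splitAt m i
... | inj₁ _ = refl
... | inj₂ _ = refl

#₁-++ : ∀ {m n} (u : Input m) (v : Input n) → #₁ (u ++ v) ≡ #₁ u + #₁ v
#₁-++ {zero}  u v = refl
#₁-++ {suc m} u v = trans
  (cong (bit (u Fin.zero) +_) (trans (#₁-cong (++-suc u v)) (#₁-++ (λ x → u (Fin.suc x)) v)))
  (sym (+-assoc (bit (u Fin.zero)) _ _))

leadingOnes : ∀ k → ℕ → Input k
leadingOnes k a p = toℕ p <ᵇ a

#₁-leadingOnes : ∀ {k} a → a ≤ k → #₁ (leadingOnes k a) ≡ a
#₁-leadingOnes {zero}  zero    z≤n       = refl
#₁-leadingOnes {suc k} zero    z≤n       = #₁-leadingOnes {k} zero z≤n
#₁-leadingOnes {suc k} (suc a) (s≤s a≤k) = cong suc (#₁-leadingOnes a a≤k)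

NotO-half : ∀ {m} (ν : Input (m + m)) → #₁ ν ≡ m → NotO (m + m) ν ≡ false
NotO-half {m} ν #₁≡m = cong (λ b → if b then false else true) (dec-true (#₀ ν ≟ #₁ ν) balanced)
  where
  balanced : #₀ ν ≡ #₁ ν
  balanced = +-cancelʳ-≡ (#₁ ν) (#₀ ν) (#₁ ν) (begin
    #₀ ν + #₁ ν ≡⟨ #₀+#₁≡n ν ⟩
    m + m       ≡⟨ cong₂ _+_ (sym #₁≡m) (sym #₁≡m) ⟩
    #₁ ν + #₁ ν ∎)
    where open ≡-Reasoning

NotO-more-than-half : ∀ {m} (ν : Input (m + m)) → m < #₁ ν → NotO (m + m) ν ≡ true
NotO-more-than-half ν m<#₁ = cong (λ b → if b then false else true) (dec-false (#₀ ν ≟ #₁ ν) unbalanced)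
  where
  unbalanced : #₀ ν ≢ #₁ ν
  unbalanced #₀≡#₁ =
    <-irrefl (sym (trans (cong (_+ #₁ ν) (sym #₀≡#₁)) (#₀+#₁≡n ν))) (+-mono-< m<#₁ m<#₁)

-- w lists the bits of the input in the order in which an OBDD with order π reads them.
fromReadOrder : ∀ {n} → Permutation n n → Input n → Input n
fromReadOrder π w x = w (π ⟨$⟩ˡ x)

fromReadOrder-read : ∀ {n} (π : Permutation n n) (w : Input n) p → fromReadOrder π w (π ⟨$⟩ʳ p) ≡ w p
fromReadOrder-read π w p = cong w (inverseˡ π)

#₁-fromReadOrder : ∀ {n} (π : Permutation n n) (w : Input n) → #₁ (fromReadOrder π w) ≡ #₁ w
#₁-fromReadOrder π w = begin
  #₁ (fromReadOrder π w)                         ≡⟨ #₁≡sum (fromReadOrder π w) ⟩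
  sum (λ i → bit (fromReadOrder π w i))          ≡⟨ sum-permute _ π ⟩
  sum (λ i → bit (fromReadOrder π w (π ⟨$⟩ʳ i))) ≡⟨ sum-cong-≗ (λ i → cong bit (fromReadOrder-read π w i)) ⟩
  sum (λ i → bit (w i))                          ≡⟨ #₁≡sum w ⟨
  #₁ w                                           ∎
  where open ≡-Reasoning

reachAux-cong : ∀ {n π} (B : OBDD n π) {ν μ : Input n} {k} (k<1+n : k < suc n) →
  reachAux B ν k k<1+n ≡ reachAux B μ k k<1+n →
  ∀ {l} (l<1+n : l < suc n) → k ≤ l →
  (∀ {j} (j<n : j < n) → k ≤ j → j < l → ν (π ⟨$⟩ʳ fromℕ< j<n) ≡ μ (π ⟨$⟩ʳ fromℕ< j<n)) →
  reachAux B ν l l<1+n ≡ reachAux B μ l l<1+n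
reachAux-cong B k<1+n same {zero} (s≤s z≤n) k≤l agree = refl
reachAux-cong B k<1+n same {suc l} (s≤s l<n) k≤1+l agree with m≤n⇒m<n∨m≡n k≤1+l
... | inj₂ refl rewrite <-irrelevant k<1+n (s≤s l<n) = same
... | inj₁ (s≤s k≤l)
  rewrite reachAux-cong B k<1+n same (m<n⇒m<1+n l<n) k≤l
            (λ j<n k≤j j<l → agree j<n k≤j (m<n⇒m<1+n j<l))
        | agree l<n k≤l ≤-refl = refl

evalOBDD-cong : ∀ {n π} (B : OBDD n π) {ν μ : Input n} {k} (k<1+n : k < suc n) →
  reachAux B ν k k<1+n ≡ reachAux B μ k k<1+n →
  (∀ {j} (j<n : j < n) → k ≤ j → ν (π ⟨$⟩ʳ fromℕ< j<n) ≡ μ (π ⟨$⟩ʳ fromℕ< j<n)) →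
  evalOBDD B ν ≡ evalOBDD B μ
evalOBDD-cong {n} B {k = k} k<1+n same agree =
  cong (λ x → OBDD.accept B (subst (λ i → Fin (OBDD.size B i)) (fromℕ<-toℕ last (toℕ<n last)) x))
       (reachAux-cong B k<1+n same (toℕ<n last) k≤last (λ j<n k≤j _ → agree j<n k≤j))
  where
  last : Fin (suc n)
  last = fromℕ n
  k≤last : k ≤ toℕ last
  k≤last = subst (k ≤_) (sym (toℕ-fromℕ n)) (s≤s⁻¹ k<1+n)

module _ {k l} {π : Permutation (k + l) (k + l)} (B : OBDD (k + l) π) where

  k<1+n : k < suc (k + l)
  k<1+n = s≤s (m≤m+n k l)

  nodeAfter : Input k → Input l → Fin (OBDD.size B (fromℕ< k<1+n))
  nodeAfter u v = reachAux B (fromReadOrder π (u ++ v)) k k<1+n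

  nodeAfter-prefix : ∀ u v v′ → nodeAfter u v ≡ nodeAfter u v′
  nodeAfter-prefix u v v′ = reachAux-cong B (s≤s z≤n) refl k<1+n z≤n λ {j} j<n _ j<k →
    let j<k′ = subst (_< k) (sym (toℕ-fromℕ< j<n)) j<k in
    begin
      fromReadOrder π (u ++ v) (π ⟨$⟩ʳ fromℕ< j<n)  ≡⟨ fromReadOrder-read π (u ++ v) _ ⟩
      (u ++ v) (fromℕ< j<n)                         ≡⟨ lookup-++-< u v _ j<k′ ⟩
      u (fromℕ< j<k′)                               ≡⟨ lookup-++-< u v′ _ j<k′ ⟨
      (u ++ v′) (fromℕ< j<n)                        ≡⟨ fromReadOrder-read π (u ++ v′) _ ⟨
      fromReadOrder π (u ++ v′) (π ⟨$⟩ʳ fromℕ< j<n) ∎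
    where open ≡-Reasoning

  cut-and-paste : ∀ u u′ v v′ → nodeAfter u v ≡ nodeAfter u′ v →
    evalOBDD B (fromReadOrder π (u ++ v′)) ≡ evalOBDD B (fromReadOrder π (u′ ++ v′))
  cut-and-paste u u′ v v′ same = evalOBDD-cong B k<1+n same′ λ {j} j<n k≤j →
    let k≤j′ = subst (k ≤_) (sym (toℕ-fromℕ< j<n)) k≤j in
    begin
      fromReadOrder π (u ++ v′) (π ⟨$⟩ʳ fromℕ< j<n)  ≡⟨ fromReadOrder-read π (u ++ v′) _ ⟩
      (u ++ v′) (fromℕ< j<n)                         ≡⟨ lookup-++-≥ u v′ _ k≤j′ ⟩
      v′ (Fin.reduce≥ (fromℕ< j<n) k≤j′)              ≡⟨ lookup-++-≥ u′ v′ _ k≤j′ ⟨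
      (u′ ++ v′) (fromℕ< j<n)                        ≡⟨ fromReadOrder-read π (u′ ++ v′) _ ⟨
      fromReadOrder π (u′ ++ v′) (π ⟨$⟩ʳ fromℕ< j<n) ∎
    where
    open ≡-Reasoning
    same′ : nodeAfter u v′ ≡ nodeAfter u′ v′
    same′ = begin
      nodeAfter u v′  ≡⟨ nodeAfter-prefix u v′ v ⟩
      nodeAfter u v   ≡⟨ same ⟩
      nodeAfter u′ v  ≡⟨ nodeAfter-prefix u′ v v′ ⟩
      nodeAfter u′ v′ ∎

  fooling-set : ∀ {f r} → Computes B f → (p : Fin r → Input k) (s : Fin r → Input l) →
    (∀ {i j} → i Fin.< j →
      f (fromReadOrder π (p i ++ s i)) ≢ f (fromReadOrder π (p j ++ s i))) →
    r ≤ OBDD.size B (fromℕ< k<1+n)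
  fooling-set {f} {r} computes p s separates with r ≤? OBDD.size B (fromℕ< k<1+n)
  ... | yes r≤size = r≤size
  -- By nodeAfter-prefix, any fixed suffix serves to name the node reached by a prefix.
  ... | no r≰size with i , j , i<j , same ← pigeonhole (≰⇒> r≰size) (λ i → nodeAfter (p i) (λ _ → false))
      = contradiction (begin
          f (fromReadOrder π (p i ++ s i))          ≡⟨ computes _ ⟨
          evalOBDD B (fromReadOrder π (p i ++ s i)) ≡⟨ cut-and-paste (p i) (p j) _ (s i) same ⟩
          evalOBDD B (fromReadOrder π (p j ++ s i)) ≡⟨ computes _ ⟩
          f (fromReadOrder π (p j ++ s i))          ∎) (separates i<j)
    where open ≡-Reasoning

size≤width : ∀ {n π} (B : OBDD n π) j → OBDD.size B j ≤ width B
size≤width B = ≤-maxF (OBDD.size B)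
  where
  ≤-maxF : ∀ {m} (f : Fin m → ℕ) j → f j ≤ maxF f
  ≤-maxF f Fin.zero    = m≤m⊔n _ _
  ≤-maxF f (Fin.suc j) = ≤-trans (≤-maxF (λ i → f (Fin.suc i)) j) (m≤n⊔m _ _)

#₁-leadingOnes-++ : ∀ {m} (π : Permutation (m + m) (m + m)) {a b} → a ≤ m → b ≤ m →
  #₁ (fromReadOrder π (leadingOnes m a ++ leadingOnes m b)) ≡ a + b
#₁-leadingOnes-++ {m} π {a} {b} a≤m b≤m = begin
  #₁ (fromReadOrder π (leadingOnes m a ++ leadingOnes m b)) ≡⟨ #₁-fromReadOrder π _ ⟩
  #₁ (leadingOnes m a ++ leadingOnes m b)                   ≡⟨ #₁-++ (leadingOnes m a) (leadingOnes m b) ⟩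
  #₁ (leadingOnes m a) + #₁ (leadingOnes m b)               ≡⟨ cong₂ _+_ (#₁-leadingOnes a a≤m) (#₁-leadingOnes b b≤m) ⟩
  a + b                                                     ∎
  where open ≡-Reasoning

NotO-separates : ∀ {m} (π : Permutation (m + m) (m + m)) {a b} → a < b → b ≤ m →
  NotO (m + m) (fromReadOrder π (leadingOnes m a ++ leadingOnes m (m ∸ a))) ≢
  NotO (m + m) (fromReadOrder π (leadingOnes m b ++ leadingOnes m (m ∸ a)))
NotO-separates {m} π {a} {b} a<b b≤m same =
  contradiction (trans (sym (NotO-half ν balanced)) (trans same (NotO-more-than-half μ unbalanced))) λ ()
  where
  ν μ : Input (m + m)
  ν = fromReadOrder π (leadingOnes m a ++ leadingOnes m (m ∸ a))
  μ = fromReadOrder π (leadingOnes m b ++ leadingOnes m (m ∸ a))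
  a≤m : a ≤ m
  a≤m = <⇒≤ (<-≤-trans a<b b≤m)
  balanced : #₁ ν ≡ m
  balanced = trans (#₁-leadingOnes-++ π a≤m (m∸n≤m m a)) (m+[n∸m]≡n a≤m)
  unbalanced : m < #₁ μ
  unbalanced = subst₂ _<_ (m+[n∸m]≡n a≤m) (sym (#₁-leadingOnes-++ π b≤m (m∸n≤m m a)))
                 (+-monoˡ-< (m ∸ a) a<b)

lemma1 : (m : ℕ) → Σ ℕ (λ n → m ≤ n ×
           ((π : Permutation n n) (B : OBDD n π) → Computes B (NotO n) → n + 2 ≤ 2 * width B))
lemma1 m = m + m , m≤m+n m m , λ π B computes →
  subst (_≤ 2 * width B) (double-suc m)
    (*-monoʳ-≤ 2 (≤-trans (level-m-size π B computes) (size≤width B _)))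
  where
  double-suc : ∀ m → 2 * suc m ≡ m + m + 2
  double-suc = solve-∀
  level-m-size : ∀ π (B : OBDD (m + m) π) → Computes B (NotO (m + m)) →
    suc m ≤ OBDD.size B (fromℕ< (k<1+n {m} {m} B))
  level-m-size π B computes =
    fooling-set {m} {m} B computes (λ i → leadingOnes m (toℕ i)) (λ i → leadingOnes m (m ∸ toℕ i))
      (λ {i} {j} i<j → NotO-separates π i<j (s≤s⁻¹ (toℕ<n j)))
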